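{- Let $G'$ be a graph with a spanning tree $T'$; colour the edges of $T'$ green and all other edges of $G'$ black. If $(G,T)$ is obtained from $(G',T')$ by a Tutte-extension or a diamond-extension, where $T$ denotes the set of green edges after the extension, then $G-E(T)$ decomposes into a 2-regular graph and a matching if and only if $G'-E(T')$ does.
   Context: All graphs are finite and simple. A decomposition of a graph into subgraphs means every edge lies in exactly one of them; the 2-regular graph and the matching may be empty. A Tutte-extension: choose two distinct green edges $x_uy_u$ and $x_vy_v$ (possibly sharing an end), subdivide them by new vertices $u$ and $v$ respectively (the four resulting edges are green), and add the black edge $uv$. A diamond-extension: choose a green edge $xy$, delete it, add new vertices $d_1,d_2,d_3,d_4$ with green edges $d_1d_3,d_3d_2,d_2d_4$ and black edges $d_1d_2,d_3d_4$, and add green edges $xd_1$ and $d_4y$. -}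

module Defs where

open import Data.Nat using (ℕ; zero; suc; _+_; _≤_)
open import Data.Fin using (Fin; zero; suc; _↑ʳ_; _≟_)
open import Data.Product using (_×_; _,_; Σ; proj₁; proj₂)
open import Data.Sum using (_⊎_)
open import Data.Bool using (if_then_else_; _∨_)
open import Data.List using (List; []; _∷_; _++_; [_]; map; length)
open import Data.List.Membership.Propositional using (_∈_)
open import Data.List.Relation.Unary.All using (All)
open import Data.List.Relation.Unary.AllPairs using (AllPairs)
open import Data.List.Relation.Unary.Linked using (Linked)
open import Data.List.Relation.Unary.Unique.Propositional using (Unique)
open import Data.List.Relation.Binary.Permutation.Propositional using (_↭_)
open import Relation.Binary.PropositionalEquality using (_≡_; _≢_)
open import Relation.Nullary using (¬_; does)

-- An edge on the vertex set Fin n, written as an (ordered) pair of its ends;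
-- it stands for the unordered edge {x , y}.
Edge : ℕ → Set
Edge n = Fin n × Fin n

SameEdge : ∀ {n} → Edge n → Edge n → Set
SameEdge (a , b) (c , d) = (a ≡ c × b ≡ d) ⊎ (a ≡ d × b ≡ c)

record CGraph (n : ℕ) : Set where
  constructor cgraph
  field
    green : List (Edge n)
    black : List (Edge n)
open CGraph public

Simple : ∀ {n} → CGraph n → Set
Simple G = All (λ e → proj₁ e ≢ proj₂ e) (green G ++ black G)
         × AllPairs (λ e f → ¬ SameEdge e f) (green G ++ black G)

Adj : ∀ {n} → List (Edge n) → Fin n → Fin n → Set
Adj L x y = (x , y) ∈ L ⊎ (y , x) ∈ L

data Walk {n} (L : List (Edge n)) : Fin n → Fin n → Set where
  here  : ∀ {x} → Walk L x x
  there : ∀ {x y z} → Adj L x y → Walk L y z → Walk L x z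

Connected : ∀ {n} → List (Edge n) → Set
Connected {n} L = (x y : Fin n) → Walk L x y

HasCycle : ∀ {n} → List (Edge n) → Set
HasCycle {n} L = Σ (Fin n) λ v → Σ (List (Fin n)) λ ws →
  (2 ≤ length ws) × Unique (v ∷ ws) × Linked (Adj L) (v ∷ ws ++ [ v ])

GreenSpanningTree : ∀ {n} → CGraph n → Set
GreenSpanningTree G = Connected (green G) × ¬ HasCycle (green G)

deg : ∀ {n} → List (Edge n) → Fin n → ℕ
deg [] v = 0
deg ((a , b) ∷ L) v = (if does (v ≟ a) ∨ does (v ≟ b) then 1 else 0) + deg L v

-- G - E(T) (the black edges) decomposes into a (possibly empty) 2-regular graph C
-- and a (possibly empty) matching M.
BlackDecomposable : ∀ {n} → CGraph n → Set
BlackDecomposable {n} G = Σ (List (Edge n)) λ C → Σ (List (Edge n)) λ M →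
  ((C ++ M) ↭ black G)
  × ((v : Fin n) → (deg C v ≡ 0) ⊎ (deg C v ≡ 2))
  × ((v : Fin n) → deg M v ≤ 1)

liftE : ∀ {n} k → Edge n → Edge (k + n)
liftE k (x , y) = k ↑ʳ x , k ↑ʳ y

-- Tutte-extension: green edges (xu,yu), (xv,yv) (distinct, as the graph is simple)
-- are subdivided by new vertices u = 0, v = 1; old vertices are shifted by 2.
tutteExt : ∀ {n} → (rest : List (Edge n)) → (xu yu xv yv : Fin n) → (blk : List (Edge n))
         → CGraph (2 + n)
tutteExt rest xu yu xv yv blk =
  cgraph (map (liftE 2) rest ++
            (((2 ↑ʳ xu) , u) ∷ (u , (2 ↑ʳ yu)) ∷ ((2 ↑ʳ xv) , v) ∷ (v , (2 ↑ʳ yv)) ∷ []))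
         ((u , v) ∷ map (liftE 2) blk)
  where
  u v : Fin (2 + _)
  u = zero
  v = suc zero

diamondExt : ∀ {n} → (rest : List (Edge n)) → (x y : Fin n) → (blk : List (Edge n))
           → CGraph (4 + n)
diamondExt rest x y blk =
  cgraph (map (liftE 4) rest ++
            ((d1 , d3) ∷ (d3 , d2) ∷ (d2 , d4) ∷ ((4 ↑ʳ x) , d1) ∷ (d4 , (4 ↑ʳ y)) ∷ []))
         ((d1 , d2) ∷ (d3 , d4) ∷ map (liftE 4) blk)
  where
  d1 d2 d3 d4 : Fin (4 + _)
  d1 = zero
  d2 = suc zero
  d3 = suc (suc zero)
  d4 = suc (suc (suc zero))

data Extension {n} (G' : CGraph n) : ∀ {m} → CGraph m → Set where
  tutte : ∀ xu yu xv yv rest →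
          green G' ↭ ((xu , yu) ∷ (xv , yv) ∷ rest) →
          Extension G' (tutteExt rest xu yu xv yv (black G'))
  diamond : ∀ x y rest →
          green G' ↭ ((x , y) ∷ rest) →
          Extension G' (diamondExt rest x y (black G'))

-- The black edges of an extension are the old black edges together with a matching
-- on the new vertices (the edge uv, resp. the edges d1d2 and d3d4).  A 2-regular
-- subgraph cannot use a vertex of black degree at most one, so in a decomposition of
-- the new black graph the new edges all lie in the matching; deleting them gives a
-- decomposition of the old black graph.  Conversely, adding them to the matching of
-- an old decomposition keeps it a matching, as they avoid all old vertices.
module Submission where

open import Defs
open import Data.Nat using (ℕ; zero; suc; _+_; _≤_; z≤n; s≤s)
open import Data.Nat.Properties using (+-assoc; m+n≡0⇒m≡0; m+n≡0⇒n≡0; m≤m+n; m≤n+m; ≤-trans; module ≤-Reasoning; +-monoʳ-≤; +-identityʳ)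
open import Data.Nat.ListAction using (sum)
open import Data.Nat.ListAction.Properties using (sum-↭)
open import Data.Fin using (Fin; zero; suc; _↑ʳ_; _↑ˡ_; _≟_; splitAt)
open import Data.Fin.Properties using (↑ˡ-injective; ↑ʳ-injective; splitAt-↑ˡ; splitAt-↑ʳ)
open import Data.Product using (_×_; _,_; Σ)
open import Data.Sum using (_⊎_; inj₁; inj₂; isInj₂)
open import Data.Bool using (if_then_else_; _∨_; true; false)
open import Data.Maybe using (Maybe; just; nothing; zip)
open import Data.List using (List; []; _∷_; _++_; map; mapMaybe)
open import Data.List.Properties using (map-++; mapMaybe-++; mapMaybe-map; mapMaybe-cong; mapMaybe-nothing; mapMaybe-map-retract)
open import Data.List.Relation.Binary.Permutation.Propositional using (_↭_; module PermutationReasoning)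
open import Data.List.Relation.Binary.Permutation.Propositional.Properties using (map⁺; mapMaybe-↭; shifts; ++⁺ˡ)
open import Function using (Injective; _∘_)
open import Function.Bundles using (_⇔_; mk⇔)
open import Relation.Nullary using (does; yes; no)
open import Relation.Nullary.Decidable using (dec-true; dec-false)
open import Relation.Binary.PropositionalEquality using (_≡_; _≢_; refl; sym; trans; cong; cong₂; module ≡-Reasoning)

incidence : ∀ {n} → Fin n → Edge n → ℕ
incidence v (a , b) = if does (v ≟ a) ∨ does (v ≟ b) then 1 else 0

incidence-fst : ∀ {n} (a b : Fin n) → incidence a (a , b) ≡ 1
incidence-fst a b rewrite dec-true (a ≟ a) refl = refl

incidence-snd : ∀ {n} (a b : Fin n) → incidence b (a , b) ≡ 1
incidence-snd a b rewrite dec-true (b ≟ b) refl with does (b ≟ a)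
... | true  = refl
... | false = refl

deg≡sum-incidence : ∀ {n} (L : List (Edge n)) v → deg L v ≡ sum (map (incidence v) L)
deg≡sum-incidence []      v = refl
deg≡sum-incidence (e ∷ L) v = cong (incidence v e +_) (deg≡sum-incidence L v)

deg-++ : ∀ {n} (L L′ : List (Edge n)) v → deg (L ++ L′) v ≡ deg L v + deg L′ v
deg-++ []      L′ v = refl
deg-++ (e ∷ L) L′ v = trans (cong (incidence v e +_) (deg-++ L L′ v)) (sym (+-assoc (incidence v e) _ _))

deg-↭ : ∀ {n} {L L′ : List (Edge n)} → L ↭ L′ → ∀ v → deg L v ≡ deg L′ v
deg-↭ {L = L} {L′} p v = begin
  deg L v                     ≡⟨ deg≡sum-incidence L v ⟩
  sum (map (incidence v) L)   ≡⟨ sum-↭ (map⁺ (incidence v) p) ⟩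
  sum (map (incidence v) L′)  ≡⟨ sym (deg≡sum-incidence L′ v) ⟩
  deg L′ v                    ∎
  where open ≡-Reasoning

mapE : ∀ {m p} → (Fin m → Fin p) → Edge m → Edge p
mapE f (x , y) = f x , f y

does-≟-injective : ∀ {m p} {f : Fin m → Fin p} → Injective _≡_ _≡_ f →
                   ∀ x y → does (f x ≟ f y) ≡ does (x ≟ y)
does-≟-injective {f = f} f-inj x y with x ≟ y
... | yes refl = dec-true (f x ≟ f x) refl
... | no x≢y   = dec-false (f x ≟ f y) (x≢y ∘ f-inj)

incidence-map-injective : ∀ {m p} {f : Fin m → Fin p} → Injective _≡_ _≡_ f →
                          ∀ v e → incidence (f v) (mapE f e) ≡ incidence v e
incidence-map-injective f-inj v (a , b)
  rewrite does-≟-injective f-inj v a | does-≟-injective f-inj v b = refl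

deg-map-injective : ∀ {m p} {f : Fin m → Fin p} → Injective _≡_ _≡_ f →
                    ∀ L v → deg (map (mapE f) L) (f v) ≡ deg L v
deg-map-injective f-inj []      v = refl
deg-map-injective f-inj (e ∷ L) v =
  cong₂ _+_ (incidence-map-injective f-inj v e) (deg-map-injective f-inj L v)

deg-map-outside-image : ∀ {m p} {f : Fin m → Fin p} {w} → (∀ x → f x ≢ w) →
                        ∀ L → deg (map (mapE f) L) w ≡ 0
deg-map-outside-image w∉f []            = refl
deg-map-outside-image w∉f ((a , b) ∷ L)
  rewrite dec-false (_ ≟ _) (w∉f a ∘ sym) | dec-false (_ ≟ _) (w∉f b ∘ sym) =
  deg-map-outside-image w∉f L

↑ʳ≢↑ˡ : ∀ k {n} (v : Fin n) (i : Fin k) → k ↑ʳ v ≢ i ↑ˡ n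
↑ʳ≢↑ˡ k {n} v i eq with trans (sym (splitAt-↑ʳ k n v)) (trans (cong (splitAt k) eq) (splitAt-↑ˡ k i n))
... | ()

data NewOrOld (k n : ℕ) : Fin (k + n) → Set where
  new : (i : Fin k) → NewOrOld k n (i ↑ˡ n)
  old : (v : Fin n) → NewOrOld k n (k ↑ʳ v)

newOrOld : ∀ k {n} (w : Fin (k + n)) → NewOrOld k n w
newOrOld zero    w       = old w
newOrOld (suc k) zero    = new zero
newOrOld (suc k) (suc w) with newOrOld k w
... | new i = new (suc i)
... | old v = old v

-- An edge survives the deletion of the new vertices iff both of its ends are old.
stripE : ∀ k {n} → Edge (k + n) → Maybe (Edge n)
stripE k (a , b) = zip (isInj₂ (splitAt k a)) (isInj₂ (splitAt k b))

strip : ∀ k {n} → List (Edge (k + n)) → List (Edge n)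
strip k = mapMaybe (stripE k)

stripE-liftE : ∀ k {n} (e : Edge n) → stripE k (liftE k e) ≡ just e
stripE-liftE k {n} (x , y) rewrite splitAt-↑ʳ k n x | splitAt-↑ʳ k n y = refl

strip-liftE : ∀ k {n} (L : List (Edge n)) → strip k (map (liftE k) L) ≡ L
strip-liftE k = mapMaybe-map-retract (stripE-liftE k)

strip-new : ∀ k {n} (L : List (Edge k)) → strip k {n} (map (mapE (_↑ˡ n)) L) ≡ []
strip-new k {n} L = begin
  strip k (map (mapE (_↑ˡ n)) L)              ≡⟨ mapMaybe-map (stripE k) (mapE (_↑ˡ n)) L ⟩
  mapMaybe (stripE k ∘ mapE (_↑ˡ n)) L        ≡⟨ mapMaybe-cong stripE-new L ⟩
  mapMaybe (λ _ → nothing) L                  ≡⟨ mapMaybe-nothing L ⟩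
  []                                          ∎
  where
  open ≡-Reasoning
  stripE-new : ∀ e → stripE k (mapE (_↑ˡ n) e) ≡ nothing
  stripE-new (i , j) rewrite splitAt-↑ˡ k i n = refl

data EdgeView (k n : ℕ) : Edge (k + n) → Set where
  lifted     : (e : Edge n) → EdgeView k n (liftE k e)
  touchesNew : ∀ {e} (i : Fin k) → incidence (i ↑ˡ n) e ≡ 1 → stripE k e ≡ nothing →
               EdgeView k n e

stripE-new-fst : ∀ k {n} (i : Fin k) b → stripE k (i ↑ˡ n , b) ≡ nothing
stripE-new-fst k {n} i b rewrite splitAt-↑ˡ k i n = refl

stripE-new-snd : ∀ k {n} (x : Fin n) (j : Fin k) → stripE k (k ↑ʳ x , j ↑ˡ n) ≡ nothing
stripE-new-snd k {n} x j rewrite splitAt-↑ʳ k n x | splitAt-↑ˡ k j n = refl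

edgeView : ∀ k {n} (e : Edge (k + n)) → EdgeView k n e
edgeView k {n} (a , b) with newOrOld k a | newOrOld k b
... | new i | _     = touchesNew i (incidence-fst (i ↑ˡ n) b) (stripE-new-fst k i b)
... | old x | new j = touchesNew j (incidence-snd (k ↑ʳ x) (j ↑ˡ n)) (stripE-new-snd k x j)
... | old x | old y = lifted (x , y)

liftE-strip : ∀ k {n} (L : List (Edge (k + n))) → (∀ i → deg L (i ↑ˡ n) ≡ 0) →
              map (liftE k) (strip k L) ≡ L
liftE-strip k []      avoids = refl
liftE-strip k {n} (e ∷ L) avoids with edgeView k e
... | lifted e′ rewrite stripE-liftE k e′ =
  cong (liftE k e′ ∷_) (liftE-strip k L (λ i → m+n≡0⇒n≡0 (incidence (i ↑ˡ n) (liftE k e′)) (avoids i)))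
... | touchesNew i incident _ with trans (sym incident) (m+n≡0⇒m≡0 (incidence (i ↑ˡ n) e) (avoids i))
...   | ()

deg-liftE-old : ∀ k {n} (L : List (Edge n)) v → deg (map (liftE k) L) (k ↑ʳ v) ≡ deg L v
deg-liftE-old k = deg-map-injective (↑ʳ-injective k _ _)

deg-liftE-new : ∀ k {n} (L : List (Edge n)) (i : Fin k) → deg (map (liftE k) L) (i ↑ˡ n) ≡ 0
deg-liftE-new k L i = deg-map-outside-image (λ v → ↑ʳ≢↑ˡ k v i) L

deg-strip : ∀ k {n} (L : List (Edge (k + n))) → (∀ i → deg L (i ↑ˡ n) ≡ 0) →
            ∀ v → deg (strip k L) v ≡ deg L (k ↑ʳ v)
deg-strip k L avoids v = begin
  deg (strip k L) v                           ≡⟨ sym (deg-liftE-old k (strip k L) v) ⟩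
  deg (map (liftE k) (strip k L)) (k ↑ʳ v)    ≡⟨ cong (λ L′ → deg L′ (k ↑ʳ v)) (liftE-strip k L avoids) ⟩
  deg L (k ↑ʳ v)                              ∎
  where open ≡-Reasoning

deg-strip≤ : ∀ k {n} (L : List (Edge (k + n))) v → deg (strip k L) v ≤ deg L (k ↑ʳ v)
deg-strip≤ k []      v = z≤n
deg-strip≤ k (e ∷ L) v with edgeView k e
... | lifted e′ rewrite stripE-liftE k e′ | incidence-map-injective (↑ʳ-injective k _ _) v e′ =
  +-monoʳ-≤ (incidence v e′) (deg-strip≤ k L v)
... | touchesNew _ _ stripped rewrite stripped = ≤-trans (deg-strip≤ k L v) (m≤n+m _ _)

IsMatching : ∀ {n} → List (Edge n) → Set
IsMatching {n} M = (v : Fin n) → deg M v ≤ 1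

-- Vertices of degree 0 are not part of the 2-regular graph.
Is2Regular : ∀ {n} → List (Edge n) → Set
Is2Regular {n} C = (v : Fin n) → (deg C v ≡ 0) ⊎ (deg C v ≡ 2)

Decomposable : ∀ {n} → List (Edge n) → Set
Decomposable {n} B = Σ (List (Edge n)) λ C → Σ (List (Edge n)) λ M →
  ((C ++ M) ↭ B) × Is2Regular C × IsMatching M

2-regular-≤1⇒0 : ∀ {d} → d ≤ 1 → (d ≡ 0) ⊎ (d ≡ 2) → d ≡ 0
2-regular-≤1⇒0 _             (inj₁ d≡0)  = d≡0
2-regular-≤1⇒0 (s≤s ())      (inj₂ refl)

module _ {k n} (N : List (Edge k)) (N-matching : IsMatching N) (B : List (Edge n)) where

  private
    N↑ : List (Edge (k + n))
    N↑ = map (mapE (_↑ˡ n)) N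

    deg-N↑-new : ∀ i → deg N↑ (i ↑ˡ n) ≡ deg N i
    deg-N↑-new = deg-map-injective (↑ˡ-injective n _ _) N

    deg-N↑-old : ∀ v → deg N↑ (k ↑ʳ v) ≡ 0
    deg-N↑-old v = deg-map-outside-image (λ i → ↑ʳ≢↑ˡ k v i ∘ sym) N

    deg-N↑++liftE-new : ∀ (L : List (Edge n)) i → deg (N↑ ++ map (liftE k) L) (i ↑ˡ n) ≤ 1
    deg-N↑++liftE-new L i
      rewrite deg-++ N↑ (map (liftE k) L) (i ↑ˡ n) | deg-N↑-new i | deg-liftE-new k L i
            | +-identityʳ (deg N i) = N-matching i

    deg-N↑++liftE-old : ∀ (L : List (Edge n)) v → deg (N↑ ++ map (liftE k) L) (k ↑ʳ v) ≡ deg L v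
    deg-N↑++liftE-old L v
      rewrite deg-++ N↑ (map (liftE k) L) (k ↑ʳ v) | deg-N↑-old v = deg-liftE-old k L v

    delete-new : Decomposable (N↑ ++ map (liftE k) B) → Decomposable B
    delete-new (C , M , C++M↭ , C-2reg , M-matching) =
      strip k C , strip k M , perm , C′-2reg , M′-matching
      where
      C-avoids-new : ∀ i → deg C (i ↑ˡ n) ≡ 0
      C-avoids-new i = 2-regular-≤1⇒0 (begin
        deg C (i ↑ˡ n)                          ≤⟨ m≤m+n _ _ ⟩
        deg C (i ↑ˡ n) + deg M (i ↑ˡ n)         ≡⟨ sym (deg-++ C M (i ↑ˡ n)) ⟩
        deg (C ++ M) (i ↑ˡ n)                   ≡⟨ deg-↭ C++M↭ (i ↑ˡ n) ⟩
        deg (N↑ ++ map (liftE k) B) (i ↑ˡ n)    ≤⟨ deg-N↑++liftE-new B i ⟩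
        1                                       ∎) (C-2reg (i ↑ˡ n))
        where open ≤-Reasoning

      perm : strip k C ++ strip k M ↭ B
      perm = begin
        strip k C ++ strip k M                   ≡⟨ sym (mapMaybe-++ (stripE k) C M) ⟩
        strip k (C ++ M)                         ↭⟨ mapMaybe-↭ (stripE k) C++M↭ ⟩
        strip k (N↑ ++ map (liftE k) B)          ≡⟨ mapMaybe-++ (stripE k) N↑ _ ⟩
        strip k N↑ ++ strip k (map (liftE k) B)  ≡⟨ cong₂ _++_ (strip-new k N) (strip-liftE k B) ⟩
        B                                        ∎
        where open PermutationReasoning

      C′-2reg : Is2Regular (strip k C)
      C′-2reg v rewrite deg-strip k C C-avoids-new v = C-2reg (k ↑ʳ v)

      M′-matching : IsMatching (strip k M)
      M′-matching v = ≤-trans (deg-strip≤ k M v) (M-matching (k ↑ʳ v))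

    add-new : Decomposable B → Decomposable (N↑ ++ map (liftE k) B)
    add-new (C , M , C++M↭ , C-2reg , M-matching) =
      map (liftE k) C , N↑ ++ map (liftE k) M , perm , C′-2reg , M′-matching
      where
      perm : map (liftE k) C ++ N↑ ++ map (liftE k) M ↭ N↑ ++ map (liftE k) B
      perm = begin
        map (liftE k) C ++ N↑ ++ map (liftE k) M    ↭⟨ shifts (map (liftE k) C) N↑ ⟩
        N↑ ++ map (liftE k) C ++ map (liftE k) M    ≡⟨ cong (N↑ ++_) (map-++ (liftE k) C M) ⟨
        N↑ ++ map (liftE k) (C ++ M)                ↭⟨ ++⁺ˡ N↑ (map⁺ (liftE k) C++M↭) ⟩
        N↑ ++ map (liftE k) B                       ∎
        where open PermutationReasoning

      C′-2reg : Is2Regular (map (liftE k) C)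
      C′-2reg w with newOrOld k w
      ... | new i = inj₁ (deg-liftE-new k C i)
      ... | old v rewrite deg-liftE-old k C v = C-2reg v

      M′-matching : IsMatching (N↑ ++ map (liftE k) M)
      M′-matching w with newOrOld k w
      ... | new i = deg-N↑++liftE-new M i
      ... | old v rewrite deg-N↑++liftE-old M v = M-matching v

  decomposable-add-new-matching : Decomposable (map (mapE (_↑ˡ n)) N ++ map (liftE k) B) ⇔ Decomposable B
  decomposable-add-new-matching = mk⇔ delete-new add-new

lemma10 : ∀ {n m} (G' : CGraph n) (G : CGraph m) →
    Simple G' → GreenSpanningTree G' → Extension G' G →
    (BlackDecomposable G ⇔ BlackDecomposable G')
lemma10 G' _ _ _ (tutte _ _ _ _ _ _) =
  decomposable-add-new-matching ((zero , suc zero) ∷ []) uv-matching (black G')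
  where
  uv-matching : IsMatching ((zero , suc zero) ∷ [])
  uv-matching zero       = s≤s z≤n
  uv-matching (suc zero) = s≤s z≤n
  uv-matching (suc (suc ()))
lemma10 G' _ _ _ (diamond _ _ _ _) =
  decomposable-add-new-matching d₁d₂-d₃d₄ d₁d₂-d₃d₄-matching (black G')
  where
  d₁d₂-d₃d₄ : List (Edge 4)
  d₁d₂-d₃d₄ = (zero , suc zero) ∷ (suc (suc zero) , suc (suc (suc zero))) ∷ []
  d₁d₂-d₃d₄-matching : IsMatching d₁d₂-d₃d₄
  d₁d₂-d₃d₄-matching zero                   = s≤s z≤n
  d₁d₂-d₃d₄-matching (suc zero)             = s≤s z≤n
  d₁d₂-d₃d₄-matching (suc (suc zero))       = s≤s z≤n
  d₁d₂-d₃d₄-matching (suc (suc (suc zero))) = s≤s z≤n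
  d₁d₂-d₃d₄-matching (suc (suc (suc (suc ()))))
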